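{- For every prime power $q$ and every function $f\colon\mathbb{F}_q\to\mathbb{F}_q$ there exists $t\in\mathbb{F}_q$ such that the set $I_f(t):=\{f(x)+tx:x\in\mathbb{F}_q\}$ satisfies $|I_f(t)|>q/2$.
   Context: $\mathbb{F}_q$ denotes the finite field with $q$ elements. -}

module Defs where

open import Data.Nat using (ℕ)
open import Data.Fin using (Fin; _≟_)
open import Data.Fin.Properties using (any?)
open import Data.Fin.Subset using (Subset; ∣_∣)
open import Data.Vec using (tabulate)
open import Data.Product using (∃)
open import Function.Bundles using (_↔_; Inverse)
open import Relation.Nullary using (¬_; does)
open import Relation.Binary.PropositionalEquality using (_≡_)
open import Algebra.Structures using (IsCommutativeRing)

record FiniteField : Set₁ where
  infixl 6 _+_
  infixl 7 _*_
  field
    Carrier : Set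
    _+_ _*_ : Carrier → Carrier → Carrier
    -_      : Carrier → Carrier
    0# 1#   : Carrier
    isCommutativeRing : IsCommutativeRing _≡_ _+_ _*_ -_ 0# 1#
    0≢1     : ¬ (0# ≡ 1#)
    inverse : ∀ x → ¬ (x ≡ 0#) → ∃ λ y → x * y ≡ 1#
    size    : ℕ
    enum    : Carrier ↔ Fin size

  image : (Carrier → Carrier) → Subset size
  image g = tabulate λ i →
    does (any? λ j → Inverse.to enum (g (Inverse.from enum j)) ≟ i)

  imageSize : (Carrier → Carrier) → ℕ
  imageSize g = ∣ image g ∣

{-# OPTIONS --safe #-}
module Submission where

-- For t ∈ 𝔽_q let E(t) be the number of pairs (x , y) with f x + t x = f y + t y.
-- Two distinct points x ≠ y collide for at most one t, so
-- Σ_t E(t) ≤ q · q + q (q − 1) < 2q², and some t has E(t) < 2q.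
-- If the fibres of x ↦ f x + t x have sizes n_v, then Σ_v n_v = q and
-- Σ_v n_v² = E(t); since 3n ≤ n² + 2 for every integer n ≥ 1, summing gives
-- 3q ≤ E(t) + 2 |I_f(t)| < 2q + 2 |I_f(t)|, that is q < 2 |I_f(t)|.

open import Defs
open import Data.Nat using (_<_; _*_)
open import Data.Product using (∃)

open import Algebra.Bundles using (Ring; CommutativeRing)
open import Level using (0ℓ)
open import Data.Bool.Base using (if_then_else_)
open import Data.Fin.Base using (Fin; zero; suc; punchIn)
open import Data.Fin.Properties using (_≟_; any?; ¬∀⟶∃¬; punchInᵢ≢i; 0≢1+n; suc-injective)
open import Data.Fin.Subset using (Subset; ∣_∣)
open import Data.Nat.Base using (ℕ; zero; suc; _+_; _≤_; z≤n)
open import Data.Nat.Properties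
  using (+-*-semiring; _≤?_; ≤-refl; ≤-reflexive; ≤-trans; <⇒≤; <⇒≱; ≰⇒>; n<1+n; m≤m+n;
         +-comm; +-identityʳ; *-identityˡ; *-identityʳ; +-mono-≤; +-mono-<-≤; +-monoˡ-<;
         +-monoʳ-<; +-cancelʳ-<; *-monoˡ-≤; module ≤-Reasoning)
open import Data.Product using (_,_; map₂)
open import Data.Vec.Base using (tabulate)
open import Data.Vec.Functional using (removeAt)
open import Function.Base using (_∘_)
open import Function.Bundles using (Inverse; Injection)
open import Function.Properties.Inverse using (↔⇒↣; ↔-sym)
open import Relation.Binary.PropositionalEquality
  using (_≡_; _≢_; refl; sym; trans; cong; cong₂; module ≡-Reasoning)
open import Relation.Nullary.Decidable using (Dec; does; yes; no; dec-true)
open import Relation.Nullary.Negation using (¬_; contradiction)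
open import Relation.Unary using (Pred; Decidable)

open import Algebra.Properties.Semiring.Sum +-*-semiring
  using (sum; sum-syntax; sum-cong-≗; sum-replicate-zero; sum-remove; ∑-comm;
         ∑-distrib-+; *-distribˡ-sum; *-distribʳ-sum)

𝟙 : ∀ {p} {P : Set p} → Dec P → ℕ
𝟙 d = if does d then 1 else 0

𝟙-yes : ∀ {p} {P : Set p} (d : Dec P) → P → 𝟙 d ≡ 1
𝟙-yes d p rewrite dec-true d p = refl

∑-const : ∀ n c → ∑[ i < n ] c ≡ n * c
∑-const zero    c = refl
∑-const (suc n) c = cong (c +_) (∑-const n c)

∑-mono-≤ : ∀ {n} {f g : Fin n → ℕ} → (∀ i → f i ≤ g i) → sum f ≤ sum g
∑-mono-≤ {zero}  f≤g = z≤n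
∑-mono-≤ {suc n} f≤g = +-mono-≤ (f≤g zero) (∑-mono-≤ (f≤g ∘ suc))

∑-mono-< : ∀ {n} {f g : Fin n → ℕ} → Fin n → (∀ i → f i < g i) → sum f < sum g
∑-mono-< {suc _} _ f<g = +-mono-<-≤ (f<g zero) (∑-mono-≤ (<⇒≤ ∘ f<g ∘ suc))

term≤∑ : ∀ {n} (h : Fin n → ℕ) i → h i ≤ sum h
term≤∑ {suc _} h i = ≤-trans (m≤m+n (h i) _) (≤-reflexive (sym (sum-remove h)))

∑<⇒∃< : ∀ {n} (h : Fin n → ℕ) {c} → sum h < n * c → ∃ λ i → h i < c
∑<⇒∃< {n} h {c} ∑h<n*c = map₂ ≰⇒> (¬∀⟶∃¬ n (λ i → c ≤ h i) (λ i → c ≤? h i) c≰∑h)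
  where
  c≰∑h : ¬ (∀ i → c ≤ h i)
  c≰∑h c≤h = <⇒≱ ∑h<n*c (≤-trans (≤-reflexive (sym (∑-const n c))) (∑-mono-≤ c≤h))

∑-𝟙-≟-* : ∀ {n} (a : Fin n) (h : Fin n → ℕ) → ∑[ v < n ] (𝟙 (a ≟ v) * h v) ≡ h a
∑-𝟙-≟-* {suc n} zero    h =
  trans (cong₂ _+_ (*-identityˡ (h zero)) (sum-replicate-zero n)) (+-identityʳ (h zero))
∑-𝟙-≟-* {suc n} (suc a) h = ∑-𝟙-≟-* a (h ∘ suc)

∑-𝟙-none : ∀ {n p} {P : Pred (Fin n) p} (P? : Decidable P) → (∀ i → ¬ P i) → ∑[ i < n ] 𝟙 (P? i) ≡ 0
∑-𝟙-none {zero}  P? ¬P = refl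
∑-𝟙-none {suc n} P? ¬P with P? zero
... | yes P0 = contradiction P0 (¬P zero)
... | no  _  = ∑-𝟙-none (P? ∘ suc) (¬P ∘ suc)

∑-𝟙-≤1 : ∀ {n p} {P : Pred (Fin n) p} (P? : Decidable P) → (∀ {i j} → P i → P j → i ≡ j) →
         ∑[ i < n ] 𝟙 (P? i) ≤ 1
∑-𝟙-≤1 {zero}  P? unique = z≤n
∑-𝟙-≤1 {suc n} P? unique with P? zero
... | yes P0 = ≤-reflexive (cong suc (∑-𝟙-none (P? ∘ suc) (λ i → 0≢1+n ∘ unique P0)))
... | no  _  = ∑-𝟙-≤1 (P? ∘ suc) (λ Pi Pj → suc-injective (unique Pi Pj))

∣tabulate∣≡∑𝟙 : ∀ {n p} {P : Pred (Fin n) p} (P? : Decidable P) →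
                ∣ tabulate (does ∘ P?) ∣ ≡ ∑[ i < n ] 𝟙 (P? i)
∣tabulate∣≡∑𝟙 {zero}  P? = refl
∣tabulate∣≡∑𝟙 {suc n} P? with P? zero
... | yes _ = cong suc (∣tabulate∣≡∑𝟙 (P? ∘ suc))
... | no  _ = ∣tabulate∣≡∑𝟙 (P? ∘ suc)

∑<2*n-of-single-spike : ∀ {n} (h : Fin n → ℕ) i → h i ≤ n → (∀ j → j ≢ i → h j ≤ 1) → sum h < 2 * n
∑<2*n-of-single-spike {suc n} h i hᵢ≤1+n h≤1 = begin-strict
  sum h                      ≡⟨ sum-remove h ⟩
  h i + sum (removeAt h i)   ≤⟨ +-mono-≤ hᵢ≤1+n (∑-mono-≤ (λ j → h≤1 (punchIn i j) (punchInᵢ≢i i j))) ⟩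
  suc n + ∑[ j < n ] 1       ≡⟨ cong (suc n +_) (trans (∑-const n 1) (*-identityʳ n)) ⟩
  suc n + n                  <⟨ +-monoʳ-< (suc n) (n<1+n n) ⟩
  suc n + suc n              ≡⟨ cong (suc n +_) (+-identityʳ (suc n)) ⟨
  2 * suc n                  ∎
  where open ≤-Reasoning

3*k≤k*k+2 : ∀ {k} → 1 ≤ k → 3 * k ≤ k * k + 2
3*k≤k*k+2 {1}                     _ = ≤-refl
3*k≤k*k+2 {2}                     _ = ≤-refl
3*k≤k*k+2 {k@(suc (suc (suc j)))} _ = ≤-trans (*-monoˡ-≤ k (m≤m+n 3 j)) (m≤m+n (k * k) 2)

module _ {m n} (G : Fin m → Fin n) where

  fibreSize : Fin n → ℕ
  fibreSize v = ∑[ i < m ] 𝟙 (G i ≟ v)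

  collisions : ℕ
  collisions = ∑[ i < m ] fibreSize (G i)

  inImage? : ∀ v → Dec (∃ λ i → G i ≡ v)
  inImage? v = any? λ i → G i ≟ v

  image : Subset n
  image = tabulate (does ∘ inImage?)

  ∑-fibreSize-* : ∀ (h : Fin n → ℕ) → ∑[ v < n ] (fibreSize v * h v) ≡ ∑[ i < m ] h (G i)
  ∑-fibreSize-* h = begin
    ∑[ v < n ] (fibreSize v * h v)
      ≡⟨ sum-cong-≗ (λ v → *-distribʳ-sum (h v) (λ i → 𝟙 (G i ≟ v))) ⟩
    ∑[ v < n ] ∑[ i < m ] (𝟙 (G i ≟ v) * h v)
      ≡⟨ ∑-comm (λ v i → 𝟙 (G i ≟ v) * h v) ⟩
    ∑[ i < m ] ∑[ v < n ] (𝟙 (G i ≟ v) * h v)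
      ≡⟨ sum-cong-≗ (λ i → ∑-𝟙-≟-* (G i) h) ⟩
    ∑[ i < m ] h (G i)
      ∎
    where open ≡-Reasoning

  ∑-fibreSize : ∑[ v < n ] fibreSize v ≡ m
  ∑-fibreSize = begin
    ∑[ v < n ] fibreSize v        ≡⟨ sum-cong-≗ (λ v → sym (*-identityʳ (fibreSize v))) ⟩
    ∑[ v < n ] (fibreSize v * 1)  ≡⟨ ∑-fibreSize-* (λ _ → 1) ⟩
    ∑[ i < m ] 1                  ≡⟨ ∑-const m 1 ⟩
    m * 1                         ≡⟨ *-identityʳ m ⟩
    m                             ∎
    where open ≡-Reasoning

  3*fibreSize≤ : ∀ v → 3 * fibreSize v ≤ fibreSize v * fibreSize v + 2 * 𝟙 (inImage? v)
  3*fibreSize≤ v with inImage? v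
  ... | yes (i , Gi≡v) = 3*k≤k*k+2 (≤-trans (≤-reflexive (sym (𝟙-yes (G i ≟ v) Gi≡v))) (term≤∑ _ i))
  ... | no  v∉image rewrite ∑-𝟙-none (λ i → G i ≟ v) (λ i Gi≡v → v∉image (i , Gi≡v)) = z≤n

  3*m≤collisions+2*∣image∣ : 3 * m ≤ collisions + 2 * ∣ image ∣
  3*m≤collisions+2*∣image∣ = begin
    3 * m
      ≡⟨ cong (3 *_) ∑-fibreSize ⟨
    3 * ∑[ v < n ] fibreSize v
      ≡⟨ *-distribˡ-sum 3 fibreSize ⟩
    ∑[ v < n ] (3 * fibreSize v)
      ≤⟨ ∑-mono-≤ 3*fibreSize≤ ⟩
    ∑[ v < n ] (fibreSize v * fibreSize v + 2 * 𝟙 (inImage? v))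
      ≡⟨ ∑-distrib-+ (λ v → fibreSize v * fibreSize v) (λ v → 2 * 𝟙 (inImage? v)) ⟩
    ∑[ v < n ] (fibreSize v * fibreSize v) + ∑[ v < n ] (2 * 𝟙 (inImage? v))
      ≡⟨ cong₂ _+_ (∑-fibreSize-* fibreSize) (sym (*-distribˡ-sum 2 (𝟙 ∘ inImage?))) ⟩
    collisions + 2 * ∑[ v < n ] 𝟙 (inImage? v)
      ≡⟨ cong (λ k → collisions + 2 * k) (∣tabulate∣≡∑𝟙 inImage?) ⟨
    collisions + 2 * ∣ image ∣
      ∎
    where open ≤-Reasoning

  collisions<2*m⇒m<2*∣image∣ : collisions < 2 * m → m < 2 * ∣ image ∣
  collisions<2*m⇒m<2*∣image∣ collisions<2*m = +-cancelʳ-< (2 * m) m (2 * ∣ image ∣) (begin-strict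
    m + 2 * m                    ≡⟨⟩
    3 * m                        ≤⟨ 3*m≤collisions+2*∣image∣ ⟩
    collisions + 2 * ∣ image ∣   <⟨ +-monoˡ-< (2 * ∣ image ∣) collisions<2*m ⟩
    2 * m + 2 * ∣ image ∣        ≡⟨ +-comm (2 * m) (2 * ∣ image ∣) ⟩
    2 * ∣ image ∣ + 2 * m        ∎)
    where open ≤-Reasoning

module _ {c ℓ} (R : Ring c ℓ) where
  open Ring R using (_≈_; _-_; +-assoc; +-congˡ; +-congʳ; setoid)
    renaming (_+_ to _⊕_; _*_ to _⊗_)
  open import Algebra.Properties.Ring R using (x[y-z]≈xy-xz; //-rightDividesˡ; +-cancelʳ)
  open import Relation.Binary.Reasoning.Setoid setoid

  ⊕⊗-shift : ∀ a b u x y → a ⊕ u ⊗ x ≈ b ⊕ u ⊗ y → a ⊕ u ⊗ (x - y) ≈ b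
  ⊕⊗-shift a b u x y eq = +-cancelʳ (u ⊗ y) (a ⊕ u ⊗ (x - y)) b (begin
    a ⊕ u ⊗ (x - y) ⊕ u ⊗ y         ≈⟨ +-assoc a (u ⊗ (x - y)) (u ⊗ y) ⟩
    a ⊕ (u ⊗ (x - y) ⊕ u ⊗ y)       ≈⟨ +-congˡ (+-congʳ (x[y-z]≈xy-xz u x y)) ⟩
    a ⊕ (u ⊗ x - u ⊗ y ⊕ u ⊗ y)     ≈⟨ +-congˡ (//-rightDividesˡ (u ⊗ y) (u ⊗ x)) ⟩
    a ⊕ u ⊗ x                       ≈⟨ eq ⟩
    b ⊕ u ⊗ y                       ∎)

module _ (F : FiniteField) where
  open FiniteField F using (0#; 1#; isCommutativeRing; inverse)
    renaming (_+_ to _⊕_; _*_ to _⊗_)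

  ring : Ring 0ℓ 0ℓ
  ring = CommutativeRing.ring (record { isCommutativeRing = isCommutativeRing })

  open Ring ring using (_-_) renaming (*-assoc to ⊗-assoc; *-identityʳ to ⊗-identityʳ)
  open import Algebra.Properties.Ring ring using (+-cancelˡ; x∙y⁻¹≈ε⇒x≈y)

  ⊗-cancelʳ-≢0 : ∀ {d} s t → d ≢ 0# → s ⊗ d ≡ t ⊗ d → s ≡ t
  ⊗-cancelʳ-≢0 {d} s t d≢0 sd≡td with inverse d d≢0
  ... | d⁻¹ , d*d⁻¹≡1 = begin
    s                ≡⟨ ⊗-identityʳ s ⟨
    s ⊗ 1#           ≡⟨ cong (s ⊗_) d*d⁻¹≡1 ⟨
    s ⊗ (d ⊗ d⁻¹)    ≡⟨ ⊗-assoc s d d⁻¹ ⟨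
    s ⊗ d ⊗ d⁻¹      ≡⟨ cong (_⊗ d⁻¹) sd≡td ⟩
    t ⊗ d ⊗ d⁻¹      ≡⟨ ⊗-assoc t d d⁻¹ ⟩
    t ⊗ (d ⊗ d⁻¹)    ≡⟨ cong (t ⊗_) d*d⁻¹≡1 ⟩
    t ⊗ 1#           ≡⟨ ⊗-identityʳ t ⟩
    t                ∎
    where open ≡-Reasoning

  slope-unique : ∀ {a b x y s t} → x ≢ y → a ⊕ s ⊗ x ≡ b ⊕ s ⊗ y → a ⊕ t ⊗ x ≡ b ⊕ t ⊗ y → s ≡ t
  slope-unique {a} {b} {x} {y} {s} {t} x≢y eₛ eₜ =
    ⊗-cancelʳ-≢0 s t (x≢y ∘ x∙y⁻¹≈ε⇒x≈y x y)
      (+-cancelˡ a (s ⊗ (x - y)) (t ⊗ (x - y))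
        (trans (⊕⊗-shift ring a b s x y eₛ) (sym (⊕⊗-shift ring a b t x y eₜ))))

module _ (F : FiniteField) (f : FiniteField.Carrier F → FiniteField.Carrier F) where
  open FiniteField F using (Carrier; size; enum; 0#) renaming (_+_ to _⊕_; _*_ to _⊗_)

  private
    to : Carrier → Fin size
    to = Inverse.to enum

    from : Fin size → Carrier
    from = Inverse.from enum

    to-injective : ∀ {x y} → to x ≡ to y → x ≡ y
    to-injective = Injection.injective (↔⇒↣ enum)

    from-injective : ∀ {i j} → from i ≡ from j → i ≡ j
    from-injective = Injection.injective (↔⇒↣ (↔-sym enum))

  -- x ↦ f x + t x read through enum, so ∣ image (line t) ∣ is definitionally its imageSize.
  line : Carrier → Fin size → Fin size
  line t i = to (f (from i) ⊕ t ⊗ from i)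

  slopesJoining : Fin size → Fin size → ℕ
  slopesJoining i j = ∑[ s < size ] 𝟙 (line (from s) j ≟ line (from s) i)

  slopesJoining-diag : ∀ i → slopesJoining i i ≡ size
  slopesJoining-diag i = begin
    slopesJoining i i  ≡⟨ sum-cong-≗ (λ s → 𝟙-yes (line (from s) i ≟ line (from s) i) refl) ⟩
    ∑[ s < size ] 1    ≡⟨ ∑-const size 1 ⟩
    size * 1           ≡⟨ *-identityʳ size ⟩
    size               ∎
    where open ≡-Reasoning

  slopesJoining-≢ : ∀ i j → j ≢ i → slopesJoining i j ≤ 1
  slopesJoining-≢ i j j≢i = ∑-𝟙-≤1 (λ s → line (from s) j ≟ line (from s) i) λ eₛ eₜ →
    from-injective (slope-unique F (j≢i ∘ from-injective) (to-injective eₛ) (to-injective eₜ))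

  ∑-collisions<2*size² : ∑[ s < size ] collisions (line (from s)) < size * (2 * size)
  ∑-collisions<2*size² = begin-strict
    ∑[ s < size ] ∑[ i < size ] ∑[ j < size ] 𝟙 (line (from s) j ≟ line (from s) i)
      ≡⟨ ∑-comm (λ s i → fibreSize (line (from s)) (line (from s) i)) ⟩
    ∑[ i < size ] ∑[ s < size ] ∑[ j < size ] 𝟙 (line (from s) j ≟ line (from s) i)
      ≡⟨ sum-cong-≗ (λ i → ∑-comm (λ s j → 𝟙 (line (from s) j ≟ line (from s) i))) ⟩
    ∑[ i < size ] ∑[ j < size ] slopesJoining i j
      <⟨ ∑-mono-< (to 0#) (λ i → ∑<2*n-of-single-spike (slopesJoining i) i
                                  (≤-reflexive (slopesJoining-diag i)) (slopesJoining-≢ i)) ⟩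
    ∑[ i < size ] (2 * size)
      ≡⟨ ∑-const size (2 * size) ⟩
    size * (2 * size)
      ∎
    where open ≤-Reasoning

  slope-with-few-collisions : ∃ λ t → collisions (line t) < 2 * size
  slope-with-few-collisions with ∑<⇒∃< _ ∑-collisions<2*size²
  ... | s , few = from s , few

lemma9 : (F : FiniteField) → (f : FiniteField.Carrier F → FiniteField.Carrier F) →
    ∃ λ (t : FiniteField.Carrier F) →
      FiniteField.size F < 2 * FiniteField.imageSize F (λ x → FiniteField._+_ F (f x) (FiniteField._*_ F t x))
lemma9 F f with slope-with-few-collisions F f
... | t , few = t , collisions<2*m⇒m<2*∣image∣ (line F f t) few
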